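{- For $m\ge0$ let $U_m=\sum_{i=0}^{2^{m+1}-1}t(i)\,2^{2^{m+1}-1-i}$ (the integer whose $2^{m+1}$-bit binary representation is $t(0)t(1)\cdots t(2^{m+1}-1)$) and let $\tau_m=U_m/(2^{2^{m+1}}-1)$, i.e. the number with purely periodic binary expansion $0.\overline{t(0)t(1)\cdots t(2^{m+1}-1)}$. Let $F_n=2^{2^n}+1$ denote the $n$-th Fermat number. Then $\tau_0=1/3$ and $$F_{m+1}\tau_{m+1}=1+(F_{m+1}-2)\tau_m\quad\text{for all } m\ge0.$$
   Context: $t(n)$ is the Thue–Morse sequence: $t(n)=0$ if the binary expansion of $n$ has an even number of $1$'s, $t(n)=1$ otherwise. -}

module Defs where

open import Data.Nat using (ℕ; zero; suc; _+_; _*_; _∸_; _^_; NonZero; _<_; _≤_; >-nonZero; s≤s; z≤n)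
open import Data.Bool using (Bool; true; false; not)
open import Data.Integer using (+_)
open import Data.Rational using (ℚ; _/_)
open import Data.Nat.DivMod using (_%_)
open import Data.Nat.Properties as NP
open import Relation.Binary.PropositionalEquality using (_≡_; refl)

-- Thue–Morse: t(n) = parity of the number of 1's in binary expansion of n.
-- Defined by well-founded recursion-free means: bit-count with fuel n
-- (n has at most n binary digits).
popcountFuel : ℕ → ℕ → ℕ
popcountFuel zero    n = 0
popcountFuel (suc k) n = n % 2 + popcountFuel k (n Data.Nat.DivMod./ 2)

popcount : ℕ → ℕ
popcount n = popcountFuel n n

t : ℕ → ℕ
t n = popcount n % 2

sumBelow : ℕ → (ℕ → ℕ) → ℕ
sumBelow zero    f = 0
sumBelow (suc k) f = sumBelow k f + f k

U : ℕ → ℕ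
U m = sumBelow L (λ i → t i * 2 ^ (L ∸ 1 ∸ i))
  where L = 2 ^ (suc m)

den : ℕ → ℕ
den m = 2 ^ (2 ^ suc m) ∸ 1

den-nonZero : ∀ m → NonZero (den m)
den-nonZero m = >-nonZero (NP.m<n⇒0<n∸m {1} {2 ^ (2 ^ suc m)} lem)
  where
  lem : 1 < 2 ^ (2 ^ suc m)
  lem = NP.^-monoʳ-< 2 (s≤s (s≤s z≤n)) {0} {2 ^ suc m} (NP.m^n>0 2 (suc m))

τ : ℕ → ℚ
τ m = (+ U m / den m) {{den-nonZero m}}

F : ℕ → ℕ
F n = 2 ^ (2 ^ n) + 1

-- Write L = 2^(m+1), N = 2^L and k = N - 1 = den m, so that τ_m = U_m / k.
-- The Thue–Morse word of length 2L is the word of length L followed by its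
-- complement, because t(2^j + i) = 1 - t(i) for i < 2^j.  Reading binary
-- words as numbers, a concatenation is a shift-and-add and a complemented
-- word of length L has value N - 1 - U_m, hence
--     U_{m+1} = N·U_m + (N - 1 - U_m) = k·(U_m + 1).
-- Together with den (m+1) = N² - 1 = k·(k + 2) and F_{m+1} = N + 1 = k + 2
-- this gives F_{m+1} τ_{m+1} = U_m + 1 = 1 + k·τ_m.
module Submission where

open import Defs
open import Data.Nat using (ℕ; suc; _∸_)
open import Data.Product using (_×_; _,_)
open import Relation.Binary.PropositionalEquality using (_≡_; refl; sym; cong; module ≡-Reasoning)

module ThueMorse where
  open import Data.Nat
  open import Data.Nat.Properties
  open import Data.Nat.DivMod
  open import Data.Nat.Divisibility using (divides)
  open import Relation.Binary.PropositionalEquality using (trans; cong₂; subst)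
  open ≡-Reasoning

  popcountFuel-zero : ∀ f → popcountFuel f 0 ≡ 0
  popcountFuel-zero zero    = refl
  popcountFuel-zero (suc f) = popcountFuel-zero f

  half-< : ∀ f n → n < 2 ^ suc f → n / 2 < 2 ^ f
  half-< f n n<2^[1+f] = m<n*o⇒m/o<n (subst (n <_) (*-comm 2 (2 ^ f)) n<2^[1+f])

  popcountFuel-extra : ∀ f j n → n < 2 ^ f → popcountFuel (f + j) n ≡ popcountFuel f n
  popcountFuel-extra zero    j zero    _         = popcountFuel-zero j
  popcountFuel-extra zero    j (suc n) (s≤s ())
  popcountFuel-extra (suc f) j n       n<2^[1+f] =
    cong (n % 2 +_) (popcountFuel-extra f j (n / 2) (half-< f n n<2^[1+f]))

  n<2^n : ∀ n → n < 2 ^ n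
  n<2^n zero    = s≤s z≤n
  n<2^n (suc n) = +-mono-≤ (m^n>0 2 n) (≤-trans (n<2^n n) (m≤m+n (2 ^ n) 0))

  popcount-fuel : ∀ f n → n < 2 ^ f → popcount n ≡ popcountFuel f n
  popcount-fuel f n n<2^f = begin
    popcountFuel n n       ≡⟨ popcountFuel-extra n f n (n<2^n n) ⟨
    popcountFuel (n + f) n ≡⟨ cong (λ g → popcountFuel g n) (+-comm n f) ⟩
    popcountFuel (f + n) n ≡⟨ popcountFuel-extra f n n n<2^f ⟩
    popcountFuel f n       ∎

  lastDigit : ∀ a i → (2 * a + i) % 2 ≡ i % 2
  lastDigit a i = begin
    (2 * a + i) % 2 ≡⟨ cong (_% 2) (+-comm (2 * a) i) ⟩
    (i + 2 * a) % 2 ≡⟨ cong (λ x → (i + x) % 2) (*-comm 2 a) ⟩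
    (i + a * 2) % 2 ≡⟨ [m+kn]%n≡m%n i a 2 ⟩
    i % 2           ∎

  leadingDigits : ∀ a i → (2 * a + i) / 2 ≡ a + i / 2
  leadingDigits a i = begin
    (2 * a + i) / 2   ≡⟨ cong (λ x → (x + i) / 2) (*-comm 2 a) ⟩
    (a * 2 + i) / 2   ≡⟨ +-distrib-/-∣ˡ i (divides a refl) ⟩
    a * 2 / 2 + i / 2 ≡⟨ cong (_+ i / 2) (m*n/n≡m a 2) ⟩
    a + i / 2         ∎

  popcountFuel-lead : ∀ k i → i < 2 ^ k → popcountFuel (suc k) (2 ^ k + i) ≡ suc (popcountFuel k i)
  popcountFuel-lead zero    zero    _         = refl
  popcountFuel-lead zero    (suc i) (s≤s ())
  popcountFuel-lead (suc k) i       i<2^[1+k] = begin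
    (2 * 2 ^ k + i) % 2 + popcountFuel (suc k) ((2 * 2 ^ k + i) / 2)
      ≡⟨ cong₂ (λ d n → d + popcountFuel (suc k) n) (lastDigit (2 ^ k) i) (leadingDigits (2 ^ k) i) ⟩
    i % 2 + popcountFuel (suc k) (2 ^ k + i / 2)
      ≡⟨ cong (i % 2 +_) (popcountFuel-lead k (i / 2) (half-< k i i<2^[1+k])) ⟩
    i % 2 + suc (popcountFuel k (i / 2))
      ≡⟨ +-suc (i % 2) _ ⟩
    suc (i % 2 + popcountFuel k (i / 2)) ∎

  parity-suc : ∀ p → suc p % 2 + p % 2 ≡ 1
  parity-suc zero    = refl
  parity-suc (suc p) = trans (+-comm (p % 2) (suc p % 2)) (parity-suc p)

  t-complement : ∀ k i → i < 2 ^ k → t (2 ^ k + i) + t i ≡ 1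
  t-complement k i i<2^k = begin
    popcount (2 ^ k + i) % 2 + popcount i % 2
      ≡⟨ cong₂ (λ p q → p % 2 + q % 2) popcount-lead (popcount-fuel k i i<2^k) ⟩
    suc (popcountFuel k i) % 2 + popcountFuel k i % 2
      ≡⟨ parity-suc (popcountFuel k i) ⟩
    1 ∎
    where
    2^k+i<2^[1+k] : 2 ^ k + i < 2 ^ suc k
    2^k+i<2^[1+k] = +-monoʳ-< (2 ^ k) (≤-trans i<2^k (m≤m+n (2 ^ k) 0))

    popcount-lead : popcount (2 ^ k + i) ≡ suc (popcountFuel k i)
    popcount-lead = trans (popcount-fuel (suc k) (2 ^ k + i) 2^k+i<2^[1+k]) (popcountFuel-lead k i i<2^k)

module BinaryWords where
  open import Data.Nat
  open import Data.Nat.Properties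
  open import Data.Nat.Tactic.RingSolver using (solve-∀)
  open import Relation.Binary.PropositionalEquality using (trans; cong₂)
  open ≡-Reasoning

  wordValue : (ℕ → ℕ) → ℕ → ℕ
  wordValue h n = sumBelow n (λ i → h i * 2 ^ (n ∸ 1 ∸ i))

  sumBelow-cong : ∀ n {f g : ℕ → ℕ} → (∀ i → i < n → f i ≡ g i) → sumBelow n f ≡ sumBelow n g
  sumBelow-cong zero    f≗g = refl
  sumBelow-cong (suc n) f≗g = cong₂ _+_ (sumBelow-cong n (λ i i<n → f≗g i (m<n⇒m<1+n i<n))) (f≗g n ≤-refl)

  sumBelow-*ˡ : ∀ c n (f : ℕ → ℕ) → sumBelow n (λ i → c * f i) ≡ c * sumBelow n f
  sumBelow-*ˡ c zero    f = sym (*-zeroʳ c)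
  sumBelow-*ˡ c (suc n) f = trans (cong (_+ c * f n) (sumBelow-*ˡ c n f)) (sym (*-distribˡ-+ c (sumBelow n f) (f n)))

  wordValue-snoc : ∀ h n → wordValue h (suc n) ≡ 2 * wordValue h n + h n
  wordValue-snoc h zero    = *-identityʳ (h 0)
  wordValue-snoc h (suc n) = cong₂ _+_ shifted (trans (cong (λ e → h (suc n) * 2 ^ e) (n∸n≡0 n)) (*-identityʳ (h (suc n))))
    where
    digit-shift : ∀ i → i < suc n → h i * 2 ^ (suc n ∸ i) ≡ 2 * (h i * 2 ^ (n ∸ i))
    digit-shift i i<1+n = begin
      h i * 2 ^ (suc n ∸ i)   ≡⟨ cong (λ e → h i * 2 ^ e) (+-∸-assoc 1 (s≤s⁻¹ i<1+n)) ⟩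
      h i * (2 * 2 ^ (n ∸ i)) ≡⟨ x*[2*y]≡2*[x*y] (h i) (2 ^ (n ∸ i)) ⟩
      2 * (h i * 2 ^ (n ∸ i)) ∎
      where
      x*[2*y]≡2*[x*y] : ∀ x y → x * (2 * y) ≡ 2 * (x * y)
      x*[2*y]≡2*[x*y] = solve-∀

    shifted : sumBelow (suc n) (λ i → h i * 2 ^ (suc n ∸ i)) ≡ 2 * wordValue h (suc n)
    shifted = trans (sumBelow-cong (suc n) digit-shift) (sumBelow-*ˡ 2 (suc n) (λ i → h i * 2 ^ (n ∸ i)))

  wordValue-++ : ∀ h a b → wordValue h (a + b) ≡ 2 ^ b * wordValue h a + wordValue (λ i → h (a + i)) b
  wordValue-++ h a zero    = begin
    wordValue h (a + 0)        ≡⟨ cong (wordValue h) (+-identityʳ a) ⟩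
    wordValue h a              ≡⟨ +-identityʳ (wordValue h a) ⟨
    wordValue h a + 0          ≡⟨ cong (_+ 0) (*-identityˡ (wordValue h a)) ⟨
    1 * wordValue h a + 0      ∎
  wordValue-++ h a (suc b) = begin
    wordValue h (a + suc b)                                ≡⟨ cong (wordValue h) (+-suc a b) ⟩
    wordValue h (suc (a + b))                              ≡⟨ wordValue-snoc h (a + b) ⟩
    2 * wordValue h (a + b) + h (a + b)                    ≡⟨ cong (λ x → 2 * x + h (a + b)) (wordValue-++ h a b) ⟩
    2 * (2 ^ b * wordValue h a + wordValue v b) + h (a + b) ≡⟨ regroup (2 ^ b) (wordValue h a) (wordValue v b) (h (a + b)) ⟩
    2 * 2 ^ b * wordValue h a + (2 * wordValue v b + v b)   ≡⟨ cong (2 * 2 ^ b * wordValue h a +_) (wordValue-snoc v b) ⟨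
    2 * 2 ^ b * wordValue h a + wordValue v (suc b)         ∎
    where
    v : ℕ → ℕ
    v i = h (a + i)

    regroup : ∀ p x y d → 2 * (p * x + y) + d ≡ 2 * p * x + (2 * y + d)
    regroup = solve-∀

  -- A word and its complement add up to the all-ones word 11…1 = 2^n - 1.
  wordValue-complement : ∀ (h g : ℕ → ℕ) n → (∀ i → i < n → h i + g i ≡ 1) →
                         wordValue h n + wordValue g n + 1 ≡ 2 ^ n
  wordValue-complement h g zero    _         = refl
  wordValue-complement h g (suc n) h+g≡1 = begin
    wordValue h (suc n) + wordValue g (suc n) + 1
      ≡⟨ cong₂ (λ x y → x + y + 1) (wordValue-snoc h n) (wordValue-snoc g n) ⟩
    2 * H + h n + (2 * G + g n) + 1    ≡⟨ regroup H G (h n) (g n) ⟩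
    2 * (H + G) + (h n + g n) + 1      ≡⟨ cong (λ d → 2 * (H + G) + d + 1) (h+g≡1 n ≤-refl) ⟩
    2 * (H + G) + 1 + 1                ≡⟨ double (H + G) ⟩
    2 * (H + G + 1)                    ≡⟨ cong (2 *_) (wordValue-complement h g n (λ i i<n → h+g≡1 i (m<n⇒m<1+n i<n))) ⟩
    2 * 2 ^ n                          ∎
    where
    H G : ℕ
    H = wordValue h n
    G = wordValue g n

    regroup : ∀ x y a b → 2 * x + a + (2 * y + b) + 1 ≡ 2 * (x + y) + (a + b) + 1
    regroup = solve-∀

    double : ∀ x → 2 * x + 1 + 1 ≡ 2 * (x + 1)
    double = solve-∀

module Recurrences where
  open import Data.Nat
  open import Data.Nat.Properties
  open import Data.Nat.Tactic.RingSolver using (solve-∀)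
  open import Relation.Binary.PropositionalEquality using (trans; cong₂)
  open ThueMorse using (t-complement)
  open BinaryWords using (wordValue; wordValue-++; wordValue-complement)
  open ≡-Reasoning

  2^2^[1+m]≡1+den : ∀ m → 2 ^ (2 ^ suc m) ≡ suc (den m)
  2^2^[1+m]≡1+den m = sym (suc-pred (2 ^ (2 ^ suc m)) {{m^n≢0 2 (2 ^ suc m)}})

  -- The Thue–Morse prefix of length 2L is the prefix of length L followed by its complement.
  U-suc : ∀ m → U (suc m) ≡ den m * suc (U m)
  U-suc m = begin
    U (suc m)                          ≡⟨ cong (λ n → wordValue t (L + n)) (+-identityʳ L) ⟩
    wordValue t (L + L)                ≡⟨ wordValue-++ t L L ⟩
    2 ^ L * U m + C                    ≡⟨ cong (λ N → N * U m + C) (2^2^[1+m]≡1+den m) ⟩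
    suc k * U m + C                    ≡⟨ regroup k (U m) C ⟩
    k * U m + (C + U m)                ≡⟨ cong (k * U m +_) C+U≡k ⟩
    k * U m + k                        ≡⟨ +-comm (k * U m) k ⟩
    k + k * U m                        ≡⟨ *-suc k (U m) ⟨
    k * suc (U m)                      ∎
    where
    L k C : ℕ
    L = 2 ^ suc m
    k = den m
    C = wordValue (λ i → t (L + i)) L

    regroup : ∀ k u c → suc k * u + c ≡ k * u + (c + u)
    regroup = solve-∀

    C+U≡k : C + U m ≡ k
    C+U≡k = suc-injective (begin
      suc (C + U m) ≡⟨ +-comm 1 (C + U m) ⟩
      C + U m + 1   ≡⟨ wordValue-complement (λ i → t (L + i)) t L (t-complement (suc m)) ⟩
      2 ^ L         ≡⟨ 2^2^[1+m]≡1+den m ⟩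
      suc k         ∎)

  -- 2^(2L) - 1 = (2^L - 1)(2^L + 1).
  den-suc : ∀ m → den (suc m) ≡ den m * (den m + 2)
  den-suc m = begin
    2 ^ (L + (L + 0)) ∸ 1    ≡⟨ cong (λ n → 2 ^ (L + n) ∸ 1) (+-identityʳ L) ⟩
    2 ^ (L + L) ∸ 1          ≡⟨ cong (_∸ 1) (^-distribˡ-+-* 2 L L) ⟩
    2 ^ L * 2 ^ L ∸ 1        ≡⟨ cong (λ N → N * N ∸ 1) (2^2^[1+m]≡1+den m) ⟩
    suc k * suc k ∸ 1        ≡⟨ cong (_∸ 1) (square k) ⟩
    k * (k + 2)              ∎
    where
    L k : ℕ
    L = 2 ^ suc m
    k = den m

    square : ∀ k → suc k * suc k ≡ suc (k * (k + 2))
    square = solve-∀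

  F-suc : ∀ m → F (suc m) ≡ den m + 2
  F-suc m = trans (cong (_+ 1) (2^2^[1+m]≡1+den m)) (sym (+-suc (den m) 1))

  F-suc∸2 : ∀ m → F (suc m) ∸ 2 ≡ den m
  F-suc∸2 m = trans (cong (_∸ 2) (F-suc m)) (m+n∸n≡m (den m) 2)

  -- The recurrence F_{m+1} U_{m+1} / den (m+1) = (den m + (F_{m+1} - 2) U_m) / den m,
  -- cross-multiplied.
  recurrence-numerators : ∀ m → F (suc m) * U (suc m) * den m ≡ (den m + (F (suc m) ∸ 2) * U m) * den (suc m)
  recurrence-numerators m = begin
    F (suc m) * U (suc m) * k               ≡⟨ cong₂ (λ f v → f * v * k) (F-suc m) (U-suc m) ⟩
    (k + 2) * (k * suc u) * k               ≡⟨ cross k u ⟩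
    (k + k * u) * (k * (k + 2))             ≡⟨ cong₂ (λ c d → (k + c * u) * d) (F-suc∸2 m) (den-suc m) ⟨
    (k + (F (suc m) ∸ 2) * u) * den (suc m) ∎
    where
    k u : ℕ
    k = den m
    u = U m

    cross : ∀ k u → (k + 2) * (k * suc u) * k ≡ (k + k * u) * (k * (k + 2))
    cross = solve-∀

-- Identities between fractions a / n of natural numbers in ℚ, proved through
-- the unnormalised representation, where they hold by integer arithmetic.
module Fractions where
  import Data.Nat as ℕ
  import Data.Nat.Properties as ℕ
  import Data.Integer as ℤ
  import Data.Integer.Properties as ℤ
  open import Data.Integer using (+_)
  open import Data.Rational using (_/_; _+_; _*_; 1ℚ; toℚᵘ)
  open import Data.Rational.Properties using (toℚᵘ-injective; toℚᵘ-homo-+; toℚᵘ-homo-*; toℚᵘ-fromℚᵘ)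
  open import Data.Rational.Unnormalised as ℚᵘ using (mkℚᵘ; *≡*)
  import Data.Rational.Unnormalised.Properties as ℚᵘ
  open import Relation.Binary.PropositionalEquality using (trans; cong₂)
  open ℚᵘ.≃-Reasoning

  toℚᵘ-/ : ∀ i n .{{_ : ℕ.NonZero n}} → toℚᵘ (i / n) ℚᵘ.≃ (i ℚᵘ./ n)
  toℚᵘ-/ i (suc n) = toℚᵘ-fromℚᵘ (mkℚᵘ i n)

  /-≡ : ∀ a b n m .{{_ : ℕ.NonZero n}} .{{_ : ℕ.NonZero m}} → a ℕ.* m ≡ b ℕ.* n → + a / n ≡ + b / m
  /-≡ a b n@(suc n-1) m@(suc m-1) am≡bn = toℚᵘ-injective (begin
    toℚᵘ (+ a / n) ≈⟨ toℚᵘ-/ (+ a) n ⟩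
    mkℚᵘ (+ a) n-1 ≈⟨ *≡* cross ⟩
    mkℚᵘ (+ b) m-1 ≈⟨ toℚᵘ-/ (+ b) m ⟨
    toℚᵘ (+ b / m) ∎)
    where
    cross : + a ℤ.* + m ≡ + b ℤ.* + n
    cross = trans (sym (ℤ.pos-* a m)) (trans (cong +_ am≡bn) (ℤ.pos-* b n))

  scale : ∀ a b n .{{_ : ℕ.NonZero n}} → (+ a / 1) * (+ b / n) ≡ + (a ℕ.* b) / n
  scale a b n@(suc n-1) = toℚᵘ-injective (begin
    toℚᵘ ((+ a / 1) * (+ b / n))                ≈⟨ toℚᵘ-homo-* (+ a / 1) (+ b / n) ⟩
    toℚᵘ (+ a / 1) ℚᵘ.* toℚᵘ (+ b / n)          ≈⟨ ℚᵘ.*-cong (toℚᵘ-/ (+ a) 1) (toℚᵘ-/ (+ b) n) ⟩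
    mkℚᵘ (+ a ℤ.* + b) (n-1 ℕ.+ 0)              ≡⟨ cong₂ mkℚᵘ (sym (ℤ.pos-* a b)) (ℕ.+-identityʳ n-1) ⟩
    mkℚᵘ (+ (a ℕ.* b)) n-1                      ≈⟨ toℚᵘ-/ (+ (a ℕ.* b)) n ⟨
    toℚᵘ (+ (a ℕ.* b) / n)                      ∎)

  one-plus : ∀ b n .{{_ : ℕ.NonZero n}} → 1ℚ + (+ b / n) ≡ + (n ℕ.+ b) / n
  one-plus b n@(suc n-1) = toℚᵘ-injective (begin
    toℚᵘ (1ℚ + (+ b / n))                       ≈⟨ toℚᵘ-homo-+ 1ℚ (+ b / n) ⟩
    toℚᵘ 1ℚ ℚᵘ.+ toℚᵘ (+ b / n)                 ≈⟨ ℚᵘ.+-congʳ (toℚᵘ 1ℚ) (toℚᵘ-/ (+ b) n) ⟩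
    mkℚᵘ (+ 1 ℤ.* + n ℤ.+ + b ℤ.* + 1) (n-1 ℕ.+ 0) ≡⟨ cong₂ mkℚᵘ numerator (ℕ.+-identityʳ n-1) ⟩
    mkℚᵘ (+ (n ℕ.+ b)) n-1                      ≈⟨ toℚᵘ-/ (+ (n ℕ.+ b)) n ⟨
    toℚᵘ (+ (n ℕ.+ b) / n)                      ∎)
    where
    numerator : + 1 ℤ.* + n ℤ.+ + b ℤ.* + 1 ≡ + (n ℕ.+ b)
    numerator = trans (cong₂ ℤ._+_ (ℤ.*-identityˡ (+ n)) (ℤ.*-identityʳ (+ b))) (sym (ℤ.pos-+ n b))

open import Data.Nat using (NonZero)
open import Data.Integer using (+_)
open import Data.Rational using (_/_; _+_; _*_; 1ℚ)
open Recurrences using (recurrence-numerators)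
open Fractions using (/-≡; scale; one-plus)

-- τ_0 = 1/3 by computation; the recurrence follows from the cross-multiplied
-- identity recurrence-numerators after writing both sides as single fractions.
lemma2 : (τ 0 ≡ + 1 / 3)
    × (∀ (m : ℕ) → (+ F (suc m) / 1) * τ (suc m) ≡ 1ℚ + (+ (F (suc m) ∸ 2) / 1) * τ m)
lemma2 = refl , recurrence
  where
  import Data.Nat as ℕ
  open ≡-Reasoning

  recurrence : ∀ m → (+ F (suc m) / 1) * τ (suc m) ≡ 1ℚ + (+ (F (suc m) ∸ 2) / 1) * τ m
  recurrence m = begin
    (+ F′ / 1) * τ (suc m)                 ≡⟨ scale F′ (U (suc m)) (den (suc m)) ⟩
    + (F′ ℕ.* U (suc m)) / den (suc m)     ≡⟨ /-≡ (F′ ℕ.* U (suc m)) (den m ℕ.+ c) (den (suc m)) (den m)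
                                                   (recurrence-numerators m) ⟩
    + (den m ℕ.+ c) / den m                ≡⟨ one-plus c (den m) ⟨
    1ℚ + (+ c / den m)                     ≡⟨ cong (_+_ 1ℚ) (scale (F′ ∸ 2) (U m) (den m)) ⟨
    1ℚ + (+ (F′ ∸ 2) / 1) * τ m            ∎
    where
    F′ c : ℕ
    F′ = F (suc m)
    c  = (F′ ∸ 2) ℕ.* U m

    instance
      den[m]≢0 : NonZero (den m)
      den[m]≢0 = den-nonZero m

      den[1+m]≢0 : NonZero (den (suc m))
      den[1+m]≢0 = den-nonZero (suc m)
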